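{- Let $G=(V,E)$ be a graph and let $C\subseteq V$ be a set of vertices that pairwise have the same type and that induces a clique in $G$ (a clique type class). Then for every satisfactory partition $(V_1,V_2)$ of $G$, either $C\subseteq V_1$ or $C\subseteq V_2$.
   Context: Two vertices $u,v$ have the same type if $N(u)\setminus\{v\}=N(v)\setminus\{u\}$, where $N(x)$ is the open neighbourhood of $x$. For $S\subseteq V$ and $v\in V$, $d_S(v)$ is the number of neighbours of $v$ in $S$. A satisfactory partition of $G$ is a partition $(V_1,V_2)$ of $V$ into two nonempty parts such that for every $v\in V$, if $v\in V_i$ then $d_{V_i}(v)\geq d_{V_{3-i}}(v)$. -}

module Defs where

open import Data.Nat using (ℕ; _≥_)
open import Data.Bool using (Bool; true; false; not; _∧_; if_then_else_)
open import Data.Fin using (Fin)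
open import Data.List using (List; filter; length)
open import Data.List using () renaming (allFin to allFinL)
open import Data.Product using (_×_; ∃)
open import Relation.Binary.PropositionalEquality using (_≡_; _≢_)
open import Data.Bool.Properties using () renaming (_≟_ to _≟B_)
open import Relation.Nullary using (¬_)

record Graph (n : ℕ) : Set where
  field
    adj     : Fin n → Fin n → Bool
    symm    : ∀ u v → adj u v ≡ adj v u
    irrefl  : ∀ v → adj v v ≡ false

open Graph public

VSet : ℕ → Set
VSet n = Fin n → Bool

_∈ₛ_ : ∀ {n} → Fin n → VSet n → Set
v ∈ₛ S = S v ≡ true

deg : ∀ {n} → Graph n → VSet n → Fin n → ℕ
deg {n} G S v = length (filter (λ u → (adj G v u ∧ S u) ≟B true) (allFinL n))

_∈N[_]_ : ∀ {n} → Fin n → Graph n → Fin n → Set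
w ∈N[ G ] x = adj G x w ≡ true

SameType : ∀ {n} → Graph n → Fin n → Fin n → Set
SameType G u v = ∀ w → w ≢ v → w ≢ u → adj G u w ≡ adj G v w

CliqueTypeClass : ∀ {n} → Graph n → VSet n → Set
CliqueTypeClass G C =
  (∀ u v → u ∈ₛ C → v ∈ₛ C → SameType G u v) ×
  (∀ u v → u ∈ₛ C → v ∈ₛ C → u ≢ v → adj G u v ≡ true)

-- A partition (V₁,V₂) given by a side function: v ∈ V₁ iff side v ≡ true,
-- V₂ = complement.
Satisfactory : ∀ {n} → Graph n → VSet n → Set
Satisfactory G V₁ =
  (∃ λ v → V₁ v ≡ true) ×
  (∃ λ v → V₁ v ≡ false) ×
  (∀ v → if V₁ v
           then deg G V₁ v ≥ deg G (λ u → not (V₁ u)) v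
           else deg G (λ u → not (V₁ u)) v ≥ deg G V₁ v)

_⊆ₛ_ : ∀ {n} → VSet n → VSet n → Set
S ⊆ₛ T = ∀ v → v ∈ₛ S → v ∈ₛ T

module Submission where

-- Suppose u, v ∈ C with u ∈ V₁ and v ∈ V₂.  Since u and v are adjacent and
-- N(u) \ {v} = N(v) \ {u}, every neighbour of u in a set S with v ∉ S is a
-- neighbour of v in S, and if moreover u ∈ S then u itself is an extra
-- neighbour of v in S; hence d_S(u) < d_S(v)  (lemma twin-deg-<).  Applying
-- this to S = V₁ and, with the roles of u and v exchanged, to S = V₂ gives
--   d_{V₁}(u) ≥ d_{V₂}(u) > d_{V₂}(v) ≥ d_{V₁}(v) > d_{V₁}(u),
-- where the two ≥ are satisfactoriness at u and at v: a contradiction.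

open import Defs
open import Data.Nat using (ℕ; _≤_; _<_; _≥_; z≤n; s≤s)
open import Data.Nat.Properties using (<-irrefl; m≤n⇒m≤1+n; module ≤-Reasoning)
open import Data.Bool using (Bool; true; false; not; _∧_)
open import Data.Bool.Properties using (∧-zeroʳ) renaming (_≟_ to _≟B_)
open import Data.Sum using (_⊎_; inj₁; inj₂)
open import Data.Product using (_,_)
open import Data.Fin using (Fin)
open import Data.Fin.Properties using (any?) renaming (_≟_ to _≟F_)
open import Data.List using (List; []; _∷_; filter; length)
open import Data.List using () renaming (allFin to allFinL)
open import Data.List.Relation.Unary.Any using (here; there)
open import Data.List.Membership.Propositional using (_∈_)
open import Data.List.Membership.Propositional.Properties using (∈-allFin)
open import Relation.Binary.PropositionalEquality using (_≡_; _≢_; refl; sym; trans; cong)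
open import Relation.Nullary using (yes; no)
open import Relation.Nullary.Decidable using (_×-dec_)
open import Data.Empty using (⊥)

count : {A : Set} → (A → Bool) → List A → ℕ
count p xs = length (filter (λ x → p x ≟B true) xs)

count-mono : {A : Set} (p q : A → Bool) (xs : List A) →
  (∀ x → p x ≡ true → q x ≡ true) → count p xs ≤ count q xs
count-mono p q [] p⇒q = z≤n
count-mono p q (x ∷ xs) p⇒q with p x in px | q x in qx
... | true  | true  = s≤s (count-mono p q xs p⇒q)
... | false | true  = m≤n⇒m≤1+n (count-mono p q xs p⇒q)
... | false | false = count-mono p q xs p⇒q
... | true  | false with () ← trans (sym qx) (p⇒q x px)

count-strict : {A : Set} (p q : A → Bool) (xs : List A) (a : A) →
  (∀ x → p x ≡ true → q x ≡ true) → p a ≡ false → q a ≡ true → a ∈ xs →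
  count p xs < count q xs
count-strict p q (x ∷ xs) a p⇒q pa qa (here refl) rewrite pa | qa =
  s≤s (count-mono p q xs p⇒q)
count-strict p q (x ∷ xs) a p⇒q pa qa (there a∈xs)
  with p x in px | q x in qx
... | true  | true  = s≤s (count-strict p q xs a p⇒q pa qa a∈xs)
... | false | true  = m≤n⇒m≤1+n (count-strict p q xs a p⇒q pa qa a∈xs)
... | false | false = count-strict p q xs a p⇒q pa qa a∈xs
... | true  | false with () ← trans (sym qx) (p⇒q x px)

-- Adjacent vertices of the same type: if u ∈ S and v ∉ S, then v has strictly
-- more neighbours in S than u, since N(u) ∩ S ⊆ N(v) ∩ S and u ∈ N(v) ∩ S.
twin-deg-< : ∀ {n} (G : Graph n) (S : VSet n) (u v : Fin n) →
  SameType G u v → adj G u v ≡ true → S u ≡ true → S v ≡ false →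
  deg G S u < deg G S v
twin-deg-< {n} G S u v same uv Su Sv =
  count-strict (λ w → adj G u w ∧ S w) (λ w → adj G v w ∧ S w) (allFinL n) u
    nbr-u⇒nbr-v u-not-own-nbr u-nbr-of-v (∈-allFin u)
  where
  nbr-u⇒nbr-v : ∀ w → adj G u w ∧ S w ≡ true → adj G v w ∧ S w ≡ true
  nbr-u⇒nbr-v w uw with w ≟F v | w ≟F u
  ... | yes refl | _ rewrite Sv | ∧-zeroʳ (adj G u w) with () ← uw
  ... | no _ | yes refl rewrite irrefl G w with () ← uw
  ... | no w≢v | no w≢u rewrite same w w≢v w≢u = uw
  u-not-own-nbr : adj G u u ∧ S u ≡ false
  u-not-own-nbr rewrite irrefl G u = refl
  u-nbr-of-v : adj G v u ∧ S u ≡ true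
  u-nbr-of-v rewrite symm G v u | uv | Su = refl

satisfied-in-V₁ : ∀ {n} (G : Graph n) (V₁ : VSet n) → Satisfactory G V₁ →
  ∀ v → V₁ v ≡ true → deg G V₁ v ≥ deg G (λ u → not (V₁ u)) v
satisfied-in-V₁ G V₁ (_ , _ , sat) v V₁v with sat v
... | sat-v rewrite V₁v = sat-v

satisfied-in-V₂ : ∀ {n} (G : Graph n) (V₁ : VSet n) → Satisfactory G V₁ →
  ∀ v → V₁ v ≡ false → deg G (λ u → not (V₁ u)) v ≥ deg G V₁ v
satisfied-in-V₂ G V₁ (_ , _ , sat) v V₁v with sat v
... | sat-v rewrite V₁v = sat-v

no-split : ∀ {n} (G : Graph n) (C : VSet n) → CliqueTypeClass G C →
  (V₁ : VSet n) → Satisfactory G V₁ →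
  ∀ u v → C u ≡ true → C v ≡ true → V₁ u ≡ true → V₁ v ≡ false → ⊥
no-split G C (same , clique) V₁ sat u v Cu Cv V₁u V₁v =
  <-irrefl refl (begin-strict
    deg G V₁ u  <⟨ d₁u<d₁v ⟩
    deg G V₁ v  ≤⟨ d₁v≤d₂v ⟩
    deg G V₂ v  <⟨ d₂v<d₂u ⟩
    deg G V₂ u  ≤⟨ d₂u≤d₁u ⟩
    deg G V₁ u  ∎)
  where
  open ≤-Reasoning
  V₂ : VSet _
  V₂ w = not (V₁ w)
  u≢v : u ≢ v
  u≢v refl with () ← trans (sym V₁u) V₁v
  uv : adj G u v ≡ true
  uv = clique u v Cu Cv u≢v
  vu : adj G v u ≡ true
  vu = trans (symm G v u) uv
  d₁u<d₁v : deg G V₁ u < deg G V₁ v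
  d₁u<d₁v = twin-deg-< G V₁ u v (same u v Cu Cv) uv V₁u V₁v
  d₂v<d₂u : deg G V₂ v < deg G V₂ u
  d₂v<d₂u = twin-deg-< G V₂ v u (same v u Cv Cu) vu (cong not V₁v) (cong not V₁u)
  d₁v≤d₂v : deg G V₁ v ≤ deg G V₂ v
  d₁v≤d₂v = satisfied-in-V₂ G V₁ sat v V₁v
  d₂u≤d₁u : deg G V₂ u ≤ deg G V₁ u
  d₂u≤d₁u = satisfied-in-V₁ G V₁ sat u V₁u

lemma1 : ∀ {n} (G : Graph n) (C : VSet n) → CliqueTypeClass G C →
    (V₁ : VSet n) → Satisfactory G V₁ →
    (C ⊆ₛ V₁) ⊎ (C ⊆ₛ (λ u → not (V₁ u)))
lemma1 G C ctc V₁ sat with any? (λ w → (C w ≟B true) ×-dec (V₁ w ≟B true))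
... | yes (u , Cu , V₁u) = inj₁ in-V₁
  where
  in-V₁ : C ⊆ₛ V₁
  in-V₁ v Cv with V₁ v in V₁v
  ... | true  = refl
  ... | false with () ← no-split G C ctc V₁ sat u v Cu Cv V₁u V₁v
... | no C∩V₁-empty = inj₂ in-V₂
  where
  in-V₂ : C ⊆ₛ (λ u → not (V₁ u))
  in-V₂ v Cv with V₁ v in V₁v
  ... | false = refl
  ... | true with () ← C∩V₁-empty (v , Cv , V₁v)
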